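{- For all $\Gamma\cup\{A,B,C\}\subseteq\mathsf{Form}_\supset$: if $\Gamma\cup\{A\}\vdash C$ and $\Gamma\cup\{B\}\vdash C$, then $\Gamma\cup\{A\lor B\}\vdash C$, where $\vdash$ is derivability in $\mathbf{S}$.
   Context: Formulas $\mathsf{Form}_\supset$ are built from a countable set of propositional variables using binary connectives $\land,\lor,\to,\supset$. The proof system $\mathbf{S}$ has axiom schemata (for all formulas $A,B,C$) (Ax1) $A\to(B\to A)$; (Ax2) $(A\to(B\to C))\to((A\to B)\to(A\to C))$; (Ax3) $(A\land B)\to A$; (Ax4) $(A\land B)\to B$; (Ax5) $(C\to A)\to((C\to B)\to(C\to(A\land B)))$; (Ax6) $A\to(A\lor B)$; (Ax7) $B\to(A\lor B)$; (Ax8) $(A\to C)\to((B\to C)\to((A\lor B)\to C))$; (AxM1) $(A\to B)\supset(A\supset B)$; (AxM2) $(A\supset(B\supset C))\to((A\supset B)\supset(A\supset C))$; (AxM3) $(A\supset(B\to C))\to(B\to(A\supset C))$; (AxM4) $(A\to(B\supset C))\to(B\supset(A\to C))$; (AxM5) $((A\supset B)\supset C)\to((A\supset C)\to C)$; (AxM6) $(A\supset C)\to((B\supset C)\to((A\lor B)\supset C))$; and the single rule (MP): from $A$ and $A\supset B$ infer $B$. $\Gamma\vdash A$ iff there is a finite sequence ending in $A$ each member of which is in $\Gamma$, an axiom instance, or obtained by (MP) from earlier members. -}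

module Defs where

open import Data.Nat using (ℕ)
open import Data.Sum using (_⊎_)
open import Relation.Binary.PropositionalEquality using (_≡_)

infixr 6 _∧_
infixr 5 _∨_
infixr 4 _⇒_ _⊃_

data Form : Set where
  var : ℕ → Form
  _∧_ : Form → Form → Form
  _∨_ : Form → Form → Form
  _⇒_ : Form → Form → Form
  _⊃_ : Form → Form → Form

FormSet : Set₁
FormSet = Form → Set

_,,_ : FormSet → Form → FormSet
(Γ ,, A) X = Γ X ⊎ X ≡ A

data Axiom : Form → Set where
  ax1  : ∀ A B → Axiom (A ⇒ (B ⇒ A))
  ax2  : ∀ A B C → Axiom ((A ⇒ (B ⇒ C)) ⇒ ((A ⇒ B) ⇒ (A ⇒ C)))
  ax3  : ∀ A B → Axiom ((A ∧ B) ⇒ A)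
  ax4  : ∀ A B → Axiom ((A ∧ B) ⇒ B)
  ax5  : ∀ A B C → Axiom ((C ⇒ A) ⇒ ((C ⇒ B) ⇒ (C ⇒ (A ∧ B))))
  ax6  : ∀ A B → Axiom (A ⇒ (A ∨ B))
  ax7  : ∀ A B → Axiom (B ⇒ (A ∨ B))
  ax8  : ∀ A B C → Axiom ((A ⇒ C) ⇒ ((B ⇒ C) ⇒ ((A ∨ B) ⇒ C)))
  axM1 : ∀ A B → Axiom ((A ⇒ B) ⊃ (A ⊃ B))
  axM2 : ∀ A B C → Axiom ((A ⊃ (B ⊃ C)) ⇒ ((A ⊃ B) ⊃ (A ⊃ C)))
  axM3 : ∀ A B C → Axiom ((A ⊃ (B ⇒ C)) ⇒ (B ⇒ (A ⊃ C)))
  axM4 : ∀ A B C → Axiom ((A ⇒ (B ⊃ C)) ⇒ (B ⊃ (A ⇒ C)))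
  axM5 : ∀ A B C → Axiom (((A ⊃ B) ⊃ C) ⇒ ((A ⊃ C) ⇒ C))
  axM6 : ∀ A B C → Axiom ((A ⊃ C) ⇒ ((B ⊃ C) ⇒ ((A ∨ B) ⊃ C)))

-- Derivability Γ ⊢ A in S (derivation trees; equivalent to the
-- finite-sequence definition). Only rule: MP from A and A ⊃ B infer B.
infix 2 _⊢_
data _⊢_ (Γ : FormSet) : Form → Set where
  hyp : ∀ {A} → Γ A → Γ ⊢ A
  ax  : ∀ {A} → Axiom A → Γ ⊢ A
  mp  : ∀ {A B} → Γ ⊢ A → Γ ⊢ (A ⊃ B) → Γ ⊢ B

-- The deduction theorem holds for ⊃: every axiom and hypothesis other than A
-- is prefixed by A ⊃ via axiom 1 and AxM1, A ⊃ A comes from the ⇒-identity,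
-- and modus ponens is internalised by AxM2. Discharging A and B turns the two
-- derivations into A ⊃ C and B ⊃ C, which AxM6 combines into (A ∨ B) ⊃ C; a
-- final modus ponens with the hypothesis A ∨ B yields C.
module Submission where

open import Defs
open import Data.Sum using (inj₁; inj₂)
open import Relation.Binary.PropositionalEquality using (refl)

variable
  Γ Δ : FormSet
  A B C : Form

⇒⇒⊃ : Γ ⊢ A ⇒ B → Γ ⊢ A ⊃ B
⇒⇒⊃ {A = A} {B} d = mp d (ax (axM1 A B))

mp⇒ : Γ ⊢ A → Γ ⊢ A ⇒ B → Γ ⊢ B
mp⇒ a f = mp a (⇒⇒⊃ f)

⊢A⇒A : Γ ⊢ A ⇒ A
⊢A⇒A {A = A} = mp⇒ (ax (ax1 A A)) (mp⇒ (ax (ax1 A (A ⇒ A))) (ax (ax2 A (A ⇒ A) A)))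

⊃-const : ∀ A → Γ ⊢ B → Γ ⊢ A ⊃ B
⊃-const {B = B} A b = ⇒⇒⊃ (mp⇒ b (ax (ax1 B A)))

⊃-mp : Γ ⊢ A ⊃ (B ⊃ C) → Γ ⊢ A ⊃ B → Γ ⊢ A ⊃ C
⊃-mp {A = A} {B} {C} f g = mp g (mp⇒ f (ax (axM2 A B C)))

deduction : (Γ ,, A) ⊢ C → Γ ⊢ A ⊃ C
deduction {A = A} (hyp (inj₁ γ))    = ⊃-const A (hyp γ)
deduction         (hyp (inj₂ refl)) = ⇒⇒⊃ ⊢A⇒A
deduction {A = A} (ax a)            = ⊃-const A (ax a)
deduction         (mp d e)          = ⊃-mp (deduction e) (deduction d)

monotone : (∀ {X} → Γ X → Δ X) → Γ ⊢ A → Δ ⊢ A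
monotone Γ⊆Δ (hyp γ)  = hyp (Γ⊆Δ γ)
monotone Γ⊆Δ (ax a)   = ax a
monotone Γ⊆Δ (mp d e) = mp (monotone Γ⊆Δ d) (monotone Γ⊆Δ e)

∨-elim⊃ : Γ ⊢ A ⊃ C → Γ ⊢ B ⊃ C → Γ ⊢ (A ∨ B) ⊃ C
∨-elim⊃ {A = A} {C} {B} f g = mp⇒ g (mp⇒ f (ax (axM6 A B C)))

mainTheorem7 : (Γ : FormSet) (A B C : Form) →
    (Γ ,, A) ⊢ C → (Γ ,, B) ⊢ C → (Γ ,, (A ∨ B)) ⊢ C
mainTheorem7 Γ A B C d e =
  mp (hyp (inj₂ refl)) (monotone inj₁ (∨-elim⊃ (deduction d) (deduction e)))
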